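{- Let $G$ be a subcubic class two graph. Then $$r(G)=\min\{|R| : R \text{ is a representative conflicting subset of } G\}.$$
   Context: All graphs are finite. A graph is subcubic if every vertex has degree at most 3; a subcubic graph is class two if it has no proper 3-edge-colouring (hence it has maximum degree 3 and a proper 4-edge-colouring). The resistance $r(G)$ of such $G$ is the minimum, over all proper 4-edge-colourings $f$ of $G$ and all colours $i$, of the size $|f^{ -1}(i)|$ of the colour class. A conflicting subgraph of $G$ is a subgraph admitting no proper 3-edge-colouring; it is a minimal conflicting subgraph if for every edge $e$ of it, removing $e$ yields a 3-edge-colourable graph. If $M_1,\dots,M_r$ are all the minimal conflicting subgraphs of $G$, a representative conflicting subset of $G$ is a set $R\subseteq E(G)$ of edges such that $R\cap E(M_i)\neq\emptyset$ for each $i$. -}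

module Defs where

open import Data.Nat using (ℕ; _≤_)
open import Data.Fin using (Fin; _≟_)
open import Data.Bool using (Bool; true; false; _∨_; T)
open import Data.List using (List; length; filter)
open import Data.List.Base using (allFin)
open import Data.Product using (Σ; _×_; _,_; proj₁; proj₂; ∃)
open import Data.Sum using (_⊎_)
open import Relation.Nullary using (¬_)
open import Relation.Nullary.Decidable using (⌊_⌋)
open import Relation.Binary.PropositionalEquality using (_≡_; _≢_)

record Graph : Set where
  field
    n : ℕ
    m : ℕ
    ends : Fin m → Fin n × Fin n
    loopless : ∀ e → proj₁ (ends e) ≢ proj₂ (ends e)
    simple : ∀ e e' →
      ((proj₁ (ends e) ≡ proj₁ (ends e')) × (proj₂ (ends e) ≡ proj₂ (ends e')))
      ⊎ ((proj₁ (ends e) ≡ proj₂ (ends e')) × (proj₂ (ends e) ≡ proj₁ (ends e')))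
      → e ≡ e'

open Graph public

countB : ∀ {k} → (Fin k → Bool) → ℕ
countB {k} p = length (filter (λ x → p x Data.Bool.≟ true) (allFin k))

Incident : (G : Graph) → Fin (m G) → Fin (n G) → Set
Incident G e v = (proj₁ (ends G e) ≡ v) ⊎ (proj₂ (ends G e) ≡ v)

incident? : (G : Graph) → Fin (m G) → Fin (n G) → Bool
incident? G e v = ⌊ proj₁ (ends G e) ≟ v ⌋ ∨ ⌊ proj₂ (ends G e) ≟ v ⌋

degree : (G : Graph) → Fin (n G) → ℕ
degree G v = countB (λ e → incident? G e v)

Subcubic : Graph → Set
Subcubic G = ∀ v → degree G v ≤ 3

Adjacent : (G : Graph) → Fin (m G) → Fin (m G) → Set
Adjacent G e e' = (e ≢ e') × ∃ λ v → Incident G e v × Incident G e' v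

-- Edge sets (subgraphs, up to isolated vertices) as boolean predicates.
EdgeSet : Graph → Set
EdgeSet G = Fin (m G) → Bool

allEdges : (G : Graph) → EdgeSet G
allEdges G _ = true

remove : (G : Graph) → EdgeSet G → Fin (m G) → EdgeSet G
remove G S e x = T? (⌊ x ≟ e ⌋)
  where
  T? : Bool → Bool
  T? true = false
  T? false = S x

ProperOn : (G : Graph) (k : ℕ) → EdgeSet G → (Fin (m G) → Fin k) → Set
ProperOn G k S c = ∀ e e' → T (S e) → T (S e') → Adjacent G e e' → c e ≢ c e'

Colourable : (G : Graph) (k : ℕ) → EdgeSet G → Set
Colourable G k S = ∃ λ (c : Fin (m G) → Fin k) → ProperOn G k S c

ProperColouring : (G : Graph) (k : ℕ) → (Fin (m G) → Fin k) → Set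
ProperColouring G k c = ProperOn G k (allEdges G) c

ClassTwo : Graph → Set
ClassTwo G = Subcubic G × ¬ Colourable G 3 (allEdges G)

Conflicting : (G : Graph) → EdgeSet G → Set
Conflicting G S = ¬ Colourable G 3 S

MinimalConflicting : (G : Graph) → EdgeSet G → Set
MinimalConflicting G S =
  Conflicting G S × (∀ e → T (S e) → Colourable G 3 (remove G S e))

RepresentativeConflictingSubset : (G : Graph) → EdgeSet G → Set
RepresentativeConflictingSubset G R =
  ∀ M → MinimalConflicting G M → ∃ λ e → T (M e) × T (R e)

classSize : (G : Graph) {k : ℕ} → (Fin (m G) → Fin k) → Fin k → ℕ
classSize G f i = countB (λ e → ⌊ f e ≟ i ⌋)

IsResistance : Graph → ℕ → Set
IsResistance G r =
  (∃ λ (f : Fin (m G) → Fin 4) → ProperColouring G 4 f × ∃ λ i → classSize G f i ≡ r)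
  × (∀ (f : Fin (m G) → Fin 4) → ProperColouring G 4 f → ∀ i → r ≤ classSize G f i)

IsMinRepresentativeSize : Graph → ℕ → Set
IsMinRepresentativeSize G r =
  (∃ λ R → RepresentativeConflictingSubset G R × countB R ≡ r)
  × (∀ R → RepresentativeConflictingSubset G R → r ≤ countB R)

module Submission where

-- If f is a proper 4-edge-colouring with a colour class R of size r(G), every conflicting
-- subgraph meets R, for outside R the colouring uses only three colours; so some representative
-- set has r(G) edges. Conversely, if R is representative then G − R contains no minimal
-- conflicting subgraph, hence is 3-edge-colourable. In a subcubic graph a proper 3-edge-colouring
-- of a subgraph can be enlarged edge by edge, using a Kempe chain switch when no colour is free,
-- until the uncoloured edges form a matching. Giving them a fourth colour yields a proper
-- 4-edge-colouring with a class of at most |R| edges, so r(G) ≤ |R|.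

open import Defs
open import Data.Nat using (ℕ; zero; suc; _≤_; _<_; z≤n; s≤s)
open import Data.Nat.Properties using (≤-trans; ≤-reflexive; <⇒≤; <⇒≱; ≮⇒≥; m≤n⇒m≤1+n)
open import Data.Nat.Induction using (<-wellFounded)
open import Induction.WellFounded using (Acc; acc)
open import Data.Fin using (Fin; zero; suc; _≟_; toℕ; fromℕ; fromℕ<; inject₁; punchIn; punchOut)
open import Data.Fin.Properties
  using ( any?; all?; toℕ<n; toℕ-fromℕ<; punchInᵢ≢i; punchOut-injective
        ; inject₁-injective; fromℕ≢inject₁)
open import Data.Fin.Permutation.Components using (transpose; transpose-inverse)
import Data.Vec.Functional as Vector
open import Data.Bool using (Bool; true; false; T; not; _∧_; _∨_; if_then_else_) renaming (_≟_ to _≟ᵇ_)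
open import Data.Bool.Properties using (T-∨; T-∧; not-involutive)
open import Data.List using (List; []; _∷_; length; filter; tabulate)
open import Data.List.Relation.Unary.All using (All; []; _∷_)
import Data.List.Relation.Unary.All as All
open import Data.List.Relation.Unary.AllPairs using ([]; _∷_)
open import Data.List.Relation.Unary.Unique.Propositional using (Unique)
open import Data.Product using (Σ; ∃; ∃₂; _×_; _,_; proj₁; proj₂)
open import Data.Sum using (_⊎_; inj₁; inj₂; [_,_]′)
open import Data.Empty using (⊥; ⊥-elim)
open import Data.Unit using (tt)
open import Function using (_∘_; id)
open import Function.Bundles using (Equivalence)
open import Relation.Nullary using (¬_; Dec; yes; no)
open import Relation.Nullary.Decidable
  using (⌊_⌋; T?; ¬?; _×-dec_; _⊎-dec_; _→-dec_; toWitness; fromWitness; decidable-stable; dec-true)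
open import Relation.Binary.PropositionalEquality
  using (_≡_; _≢_; refl; sym; trans; cong; subst; _≗_; module ≡-Reasoning)
open ≡-Reasoning

T-not⁺ : ∀ {b} → ¬ T b → T (not b)
T-not⁺ {true}  ¬b = ¬b tt
T-not⁺ {false} _  = tt

T-not⁻ : ∀ {b} → T (not b) → ¬ T b
T-not⁻ {true} ()

if-T : ∀ {A : Set} {b} {x y : A} → T b → (if b then x else y) ≡ x
if-T {b = true} _ = refl

if-¬T : ∀ {A : Set} {b} {x y : A} → ¬ T b → (if b then x else y) ≡ y
if-¬T {b = true}  ¬b = ⊥-elim (¬b tt)
if-¬T {b = false} _  = refl

∉⇒≢ : ∀ {k} (p : Fin k → Bool) {x y} → ¬ T (p x) → T (p y) → x ≢ y
∉⇒≢ p x∉p y∈p refl = x∉p y∈p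

_⊆_ : ∀ {k} → (Fin k → Bool) → (Fin k → Bool) → Set
p ⊆ q = ∀ x → T (p x) → T (q x)

count : ∀ {k} → (Fin k → Bool) → ℕ
count {zero}  p = 0
count {suc k} p with p zero
... | true  = suc (count (p ∘ suc))
... | false = count (p ∘ suc)

count-tabulate : ∀ {j k} (f : Fin k → Fin j) (p : Fin j → Bool) →
  length (filter (λ x → p x ≟ᵇ true) (tabulate f)) ≡ count (p ∘ f)
count-tabulate {k = zero}  f p = refl
count-tabulate {k = suc k} f p with p (f zero)
... | true  = cong suc (count-tabulate (f ∘ suc) p)
... | false = count-tabulate (f ∘ suc) p

countB≡count : ∀ {k} (p : Fin k → Bool) → countB p ≡ count p
countB≡count = count-tabulate id

count-cong : ∀ {k} {p q : Fin k → Bool} → p ≗ q → count p ≡ count q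
count-cong {zero}          p≗q = refl
count-cong {suc k} {p} {q} p≗q with p zero | q zero | p≗q zero
... | true  | true  | _ = cong suc (count-cong (p≗q ∘ suc))
... | false | false | _ = count-cong (p≗q ∘ suc)

count-mono : ∀ {k} {p q : Fin k → Bool} → p ⊆ q → count p ≤ count q
count-mono {zero}          p⊆q = z≤n
count-mono {suc k} {p} {q} p⊆q with p zero | q zero | p⊆q zero
... | true  | true  | _  = s≤s (count-mono (p⊆q ∘ suc))
... | true  | false | p₀ = ⊥-elim (p₀ tt)
... | false | true  | _  = m≤n⇒m≤1+n (count-mono (p⊆q ∘ suc))
... | false | false | _  = count-mono (p⊆q ∘ suc)

count-mono-< : ∀ {k} {p q : Fin k → Bool} → p ⊆ q → ∀ x → T (q x) → ¬ T (p x) → count p < count q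
count-mono-< {suc k} {p} {q} p⊆q zero qx ¬px with p zero | q zero | p⊆q zero
... | true  | _     | _ = ⊥-elim (¬px tt)
... | false | true  | _ = s≤s (count-mono (p⊆q ∘ suc))
count-mono-< {suc k} {p} {q} p⊆q (suc x) qx ¬px with p zero | q zero | p⊆q zero
... | true  | true  | _  = s≤s (count-mono-< (p⊆q ∘ suc) x qx ¬px)
... | true  | false | p₀ = ⊥-elim (p₀ tt)
... | false | true  | _  = m≤n⇒m≤1+n (count-mono-< (p⊆q ∘ suc) x qx ¬px)
... | false | false | _  = count-mono-< (p⊆q ∘ suc) x qx ¬px

insert : ∀ {k} → (Fin k → Bool) → Fin k → (Fin k → Bool)
insert p x y = ⌊ y ≟ x ⌋ ∨ p y

∈-insert : ∀ {k} (p : Fin k → Bool) x → T (insert p x x)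
∈-insert p x = Equivalence.from T-∨ (inj₁ (fromWitness {a? = x ≟ x} refl))

⊆-insert : ∀ {k} (p : Fin k → Bool) x → p ⊆ insert p x
⊆-insert p x y = Equivalence.from (T-∨ {⌊ y ≟ x ⌋}) ∘ inj₂

∈-insert⁻ : ∀ {k} (p : Fin k → Bool) x y → T (insert p x y) → y ≡ x ⊎ T (p y)
∈-insert⁻ p x y y∈ with Equivalence.to (T-∨ {⌊ y ≟ x ⌋}) y∈
... | inj₁ y≡x = inj₁ (toWitness y≡x)
... | inj₂ py  = inj₂ py

insert-shrinks-complement : ∀ {k} (p : Fin k → Bool) {x} → ¬ T (p x) →
  count (not ∘ insert p x) < count (not ∘ p)
insert-shrinks-complement p {x} x∉p =
  count-mono-< ∁-antitone x (T-not⁺ x∉p) (λ x∉p+x → T-not⁻ x∉p+x (∈-insert p x))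
  where
  ∁-antitone : (not ∘ insert p x) ⊆ (not ∘ p)
  ∁-antitone y y∉p+x = T-not⁺ (T-not⁻ y∉p+x ∘ ⊆-insert p x y)

-- P must respect pointwise equality, as function extensionality is not available.
any-function? : ∀ m {k} (P : (Fin m → Fin k) → Set) → (∀ f → Dec (P f)) →
  (∀ {f g} → f ≗ g → P f → P g) → Dec (∃ P)
any-function? zero P P? resp with P? (λ ())
... | yes pf = yes (_ , pf)
... | no ¬pf = no λ (f , pf) → ¬pf (resp (λ ()) pf)
any-function? (suc m) P P? resp
  with any? (λ a → any-function? m (P ∘ (a Vector.∷_)) (P? ∘ (a Vector.∷_))
                     (λ f≗g → resp λ { zero → refl ; (suc x) → f≗g x }))
... | yes (_ , _ , pf) = yes (_ , pf)
... | no ¬pf = no λ (f , pf) → ¬pf (f zero , f ∘ suc , resp (λ { zero → refl ; (suc x) → refl }) pf)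

transpose-injective : ∀ {n} (i j : Fin n) {x y} → transpose i j x ≡ transpose i j y → x ≡ y
transpose-injective i j eq =
  trans (sym (transpose-inverse j i)) (trans (cong (transpose j i) eq) (transpose-inverse j i))

transpose-left : ∀ {n} (i j : Fin n) → transpose i j i ≡ j
transpose-left i j rewrite dec-true (i ≟ i) refl = refl

transpose-right : ∀ {n} (i j : Fin n) → transpose i j j ≡ i
transpose-right i j with j ≟ i
... | yes j≡i = j≡i
... | no _ rewrite dec-true (j ≟ j) refl = refl

transpose-pair : ∀ {n} {i j x : Fin n} → x ≡ i ⊎ x ≡ j → transpose i j x ≡ i ⊎ transpose i j x ≡ j
transpose-pair {i = i} {j} (inj₁ refl) = inj₂ (transpose-left i j)
transpose-pair {i = i} {j} (inj₂ refl) = inj₁ (transpose-right i j)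

three-in-two : ∀ {A : Set} {p q x y z : A} →
  x ≡ p ⊎ x ≡ q → y ≡ p ⊎ y ≡ q → z ≡ p ⊎ z ≡ q → x ≡ y ⊎ x ≡ z ⊎ y ≡ z
three-in-two (inj₁ refl) (inj₁ refl) _           = inj₁ refl
three-in-two (inj₂ refl) (inj₂ refl) _           = inj₁ refl
three-in-two (inj₁ refl) (inj₂ refl) (inj₁ refl) = inj₂ (inj₁ refl)
three-in-two (inj₁ refl) (inj₂ refl) (inj₂ refl) = inj₂ (inj₂ refl)
three-in-two (inj₂ refl) (inj₁ refl) (inj₁ refl) = inj₂ (inj₂ refl)
three-in-two (inj₂ refl) (inj₁ refl) (inj₂ refl) = inj₂ (inj₁ refl)

least-witness : (Q : ℕ → Set) → (∀ j → Dec (Q j)) → ∀ {k} → Q k →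
  ∃ λ r → Q r × ∀ j → Q j → r ≤ j
least-witness Q Q? {k} qk = go k (<-wellFounded k) qk
  where
  go : ∀ k → Acc _<_ k → Q k → ∃ λ r → Q r × ∀ j → Q j → r ≤ j
  go k (acc rec) qk with any? (λ (j : Fin k) → Q? (toℕ j))
  ... | yes (j , qj) = go (toℕ j) (rec (toℕ<n j)) qj
  ... | no none = k , qk , λ j qj →
    ≮⇒≥ λ j<k → none (fromℕ< j<k , subst Q (sym (toℕ-fromℕ< j<k)) qj)

module GraphFacts (G : Graph) where

  private
    V = Fin (n G)
    E = Fin (m G)

  Incident? : ∀ e v → Dec (Incident G e v)
  Incident? e v = (proj₁ (ends G e) ≟ v) ⊎-dec (proj₂ (ends G e) ≟ v)

  Incident⇒incident : ∀ {e v} → Incident G e v → T (incident? G e v)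
  Incident⇒incident {e} {v} i =
    Equivalence.from T-∨ (Data.Sum.map (fromWitness {a? = proj₁ (ends G e) ≟ v})
                                       (fromWitness {a? = proj₂ (ends G e) ≟ v}) i)

  adjacent? : ∀ e e' → Dec (Adjacent G e e')
  adjacent? e e' = ¬? (e ≟ e') ×-dec any? (λ v → Incident? e v ×-dec Incident? e' v)

  adjacent-sym : ∀ {e e'} → Adjacent G e e' → Adjacent G e' e
  adjacent-sym (e≢e' , v , i , i') = e≢e' ∘ sym , v , i' , i

  other : ∀ e v → Incident G e v → V
  other e v (inj₁ _) = proj₂ (ends G e)
  other e v (inj₂ _) = proj₁ (ends G e)

  other-incident : ∀ e v i → Incident G e (other e v i)
  other-incident e v (inj₁ _) = inj₂ refl
  other-incident e v (inj₂ _) = inj₁ refl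

  other≢ : ∀ e v i → v ≢ other e v i
  other≢ e v (inj₁ refl) = loopless G e
  other≢ e v (inj₂ refl) = loopless G e ∘ sym

  incident⇒end : ∀ e v i {z} → Incident G e z → z ≡ v ⊎ z ≡ other e v i
  incident⇒end e v (inj₁ refl) (inj₁ refl) = inj₁ refl
  incident⇒end e v (inj₁ _)    (inj₂ refl) = inj₂ refl
  incident⇒end e v (inj₂ _)    (inj₁ refl) = inj₂ refl
  incident⇒end e v (inj₂ refl) (inj₂ refl) = inj₁ refl

  other-injective : ∀ e e' v i i' → other e v i ≡ other e' v i' → e ≡ e'
  other-injective e e' v (inj₁ p) (inj₁ p') q = simple G e e' (inj₁ (trans p (sym p') , q))
  other-injective e e' v (inj₁ p) (inj₂ p') q = simple G e e' (inj₂ (trans p (sym p') , q))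
  other-injective e e' v (inj₂ p) (inj₁ p') q = simple G e e' (inj₂ (q , trans p (sym p')))
  other-injective e e' v (inj₂ p) (inj₂ p') q = simple G e e' (inj₁ (q , trans p (sym p')))

  remove-⊆ : ∀ S e → remove G S e ⊆ S
  remove-⊆ S e x x∈ with x ≟ e
  ... | no _ = x∈

  ∉-remove : ∀ S e → ¬ T (remove G S e e)
  ∉-remove S e e∈ with e ≟ e
  ... | no e≢e = e≢e refl

  ∈-remove : ∀ S e {x} → x ≢ e → T (S x) → T (remove G S e x)
  ∈-remove S e {x} x≢e x∈ with x ≟ e
  ... | yes x≡e = x≢e x≡e
  ... | no _    = x∈

  count-remove : ∀ S {e} → T (S e) → count (remove G S e) < count S
  count-remove S {e} e∈S = count-mono-< (remove-⊆ S e) e e∈S (∉-remove S e)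

  distinct-members≤count : ∀ S (xs : List E) → Unique xs → All (T ∘ S) xs → length xs ≤ count S
  distinct-members≤count S []       _              _           = z≤n
  distinct-members≤count S (x ∷ xs) (x∉xs ∷ uniq) (x∈S ∷ xs⊆S) =
    ≤-trans (s≤s (distinct-members≤count (remove G S x) xs uniq xs⊆S-x)) (count-remove S x∈S)
    where
    xs⊆S-x = All.zipWith (λ (x≢y , y∈S) → ∈-remove S x (x≢y ∘ sym) y∈S) (x∉xs , xs⊆S)

  proper? : ∀ {k} S (c : E → Fin k) → Dec (ProperOn G k S c)
  proper? S c = all? λ e → all? λ e' →
    T? (S e) →-dec T? (S e') →-dec adjacent? e e' →-dec ¬? (c e ≟ c e')

  proper-cong : ∀ {k S} {c c' : E → Fin k} → c ≗ c' → ProperOn G k S c → ProperOn G k S c'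
  proper-cong c≗c' proper e e' e∈ e'∈ adj eq =
    proper e e' e∈ e'∈ adj (trans (c≗c' e) (trans eq (sym (c≗c' e'))))

  colourable? : ∀ S → Dec (Colourable G 3 S)
  colourable? S = any-function? (m G) (ProperOn G 3 S) (proper? S) proper-cong

  minimal-conflicting-within : ∀ M → Conflicting G M → ∃ λ M' → MinimalConflicting G M' × M' ⊆ M
  minimal-conflicting-within M = go M (<-wellFounded (count M))
    where
    go : ∀ M → Acc _<_ (count M) → Conflicting G M → ∃ λ M' → MinimalConflicting G M' × M' ⊆ M
    go M (acc rec) conflicting with any? (λ e → T? (M e) ×-dec ¬? (colourable? (remove G M e)))
    ... | yes (e , e∈M , conflicting-e) =
      let (M' , minimal , M'⊆M-e) = go (remove G M e) (rec (count-remove M e∈M)) conflicting-e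
      in M' , minimal , λ x → remove-⊆ M e x ∘ M'⊆M-e x
    ... | no none = M , (conflicting , minimal) , λ _ → id
      where
      minimal : ∀ e → T (M e) → Colourable G 3 (remove G M e)
      minimal e e∈M = decidable-stable (colourable? _) λ conflicting-e → none (e , e∈M , conflicting-e)

  Missing : EdgeSet G → (E → Fin 3) → V → Fin 3 → Set
  Missing S c v k = ∀ h → T (S h) → Incident G h v → c h ≢ k

  Present : EdgeSet G → (E → Fin 3) → V → Fin 3 → Set
  Present S c v k = ∃ λ h → T (S h) × Incident G h v × c h ≡ k

  present-or-missing : ∀ S c v k → Present S c v k ⊎ Missing S c v k
  present-or-missing S c v k with any? (λ h → T? (S h) ×-dec Incident? h v ×-dec (c h ≟ k))
  ... | yes present = inj₁ present
  ... | no ¬present = inj₂ λ h h∈S i ch≡k → ¬present (h , h∈S , i , ch≡k)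

  only-edge-missing : ∀ {S c v g k} → (∀ h → T (S h) → Incident G h v → h ≡ g) → c g ≢ k →
    Missing S c v k
  only-edge-missing only cg≢k h h∈S i with only h h∈S i
  ... | refl = cg≢k

  recolour : (E → Fin 3) → E → Fin 3 → E → Fin 3
  recolour c x k y with y ≟ x
  ... | yes _ = k
  ... | no _  = c y

  Extensible : EdgeSet G → Set
  Extensible S = ∃ λ x → ¬ T (S x) × Colourable G 3 (insert S x)

  colour-edge : ∀ {S c e v} k → ProperOn G 3 S c → ¬ T (S e) → (i : Incident G e v) →
    Missing S c v k → Missing S c (other e v i) k → Extensible S
  colour-edge {S} {c} {e} {v} k proper e∉S i free-v free-u = e , e∉S , recolour c e k , proper'
    where
    free-adjacent : ∀ y → T (S y) → Adjacent G e y → c y ≢ k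
    free-adjacent y y∈S (_ , z , ie , iy) with incident⇒end e v i ie
    ... | inj₁ refl = free-v y y∈S iy
    ... | inj₂ refl = free-u y y∈S iy

    proper' : ProperOn G 3 (insert S e) (recolour c e k)
    proper' y y' y∈ y'∈ adj with y ≟ e | y' ≟ e
    ... | yes refl | yes refl = λ _ → proj₁ adj refl
    ... | yes refl | no _     = free-adjacent y' y'∈ adj ∘ sym
    ... | no _     | yes refl = free-adjacent y y∈ (adjacent-sym adj)
    ... | no _     | no _     = proper y y' y∈ y'∈ adj

module SubcubicFacts (G : Graph) (subcubic : Subcubic G) where

  open GraphFacts G

  no-four-edges-at : ∀ v {x₁ x₂ x₃ x₄} →
    Incident G x₁ v → Incident G x₂ v → Incident G x₃ v → Incident G x₄ v →
    x₁ ≢ x₂ → x₁ ≢ x₃ → x₁ ≢ x₄ → x₂ ≢ x₃ → x₂ ≢ x₄ → x₃ ≢ x₄ → ⊥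
  no-four-edges-at v i₁ i₂ i₃ i₄ d₁₂ d₁₃ d₁₄ d₂₃ d₂₄ d₃₄ =
    <⇒≱ four≤degree (subst (_≤ 3) (countB≡count (λ e → incident? G e v)) (subcubic v))
    where
    four≤degree : 4 ≤ count (λ e → incident? G e v)
    four≤degree = distinct-members≤count _ (_ ∷ _ ∷ _ ∷ _ ∷ [])
      ((d₁₂ ∷ d₁₃ ∷ d₁₄ ∷ []) ∷ (d₂₃ ∷ d₂₄ ∷ []) ∷ (d₃₄ ∷ []) ∷ [] ∷ [])
      ( Incident⇒incident i₁ ∷ Incident⇒incident i₂
      ∷ Incident⇒incident i₃ ∷ Incident⇒incident i₄ ∷ [])

  coloured-edge-unique : ∀ S {v e e' h h'} → ¬ T (S e) → ¬ T (S e') → e ≢ e' →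
    Incident G e v → Incident G e' v → T (S h) → T (S h') →
    Incident G h v → Incident G h' v → h ≡ h'
  coloured-edge-unique S {h = h} {h'} e∉S e'∉S e≢e' ie ie' h∈S h'∈S ih ih' with h ≟ h'
  ... | yes h≡h' = h≡h'
  ... | no h≢h' = ⊥-elim (no-four-edges-at _ ie ie' ih ih' e≢e'
          (∉⇒≢ S e∉S h∈S) (∉⇒≢ S e∉S h'∈S) (∉⇒≢ S e'∉S h∈S) (∉⇒≢ S e'∉S h'∈S)
          h≢h')

  missing-colour-exists : ∀ S c {e u} → ¬ T (S e) → Incident G e u → ∃ λ k → Missing S c u k
  missing-colour-exists S c {u = u} e∉S ie
    with present-or-missing S c u zero | present-or-missing S c u (suc zero)
       | present-or-missing S c u (suc (suc zero))
  ... | inj₂ free | _ | _ = _ , free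
  ... | _ | inj₂ free | _ = _ , free
  ... | _ | _ | inj₂ free = _ , free
  ... | inj₁ (h₀ , h₀∈S , i₀ , c₀) | inj₁ (h₁ , h₁∈S , i₁ , c₁)
      | inj₁ (h₂ , h₂∈S , i₂ , c₂) =
    ⊥-elim (no-four-edges-at u ie i₀ i₁ i₂
      (∉⇒≢ S e∉S h₀∈S) (∉⇒≢ S e∉S h₁∈S) (∉⇒≢ S e∉S h₂∈S)
      (colours-differ c₀ c₁ λ ()) (colours-differ c₀ c₂ λ ()) (colours-differ c₁ c₂ λ ()))
    where
    colours-differ : ∀ {x y k l} → c x ≡ k → c y ≡ l → k ≢ l → x ≢ y
    colours-differ refl refl k≢l refl = k≢l refl

module KempeChains (G : Graph) {S : EdgeSet G} {c : Fin (m G) → Fin 3} (proper : ProperOn G 3 S c)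
                   {a b : Fin 3} where

  open GraphFacts G

  private
    V = Fin (n G)
    E = Fin (m G)

  H : EdgeSet G
  H y = S y ∧ (⌊ c y ≟ a ⌋ ∨ ⌊ c y ≟ b ⌋)

  H⇒S : ∀ {y} → T (H y) → T (S y)
  H⇒S = proj₁ ∘ Equivalence.to T-∧

  H-colour : ∀ {y} → T (H y) → c y ≡ a ⊎ c y ≡ b
  H-colour {y} y∈H with Equivalence.to (T-∨ {⌊ c y ≟ a ⌋}) (proj₂ (Equivalence.to (T-∧ {S y}) y∈H))
  ... | inj₁ cy≡a = inj₁ (toWitness cy≡a)
  ... | inj₂ cy≡b = inj₂ (toWitness cy≡b)

  H-intro : ∀ {y} → T (S y) → c y ≡ a ⊎ c y ≡ b → T (H y)
  H-intro {y} y∈S colour = Equivalence.from T-∧ (y∈S ,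
    Equivalence.from T-∨ (Data.Sum.map (fromWitness {a? = c y ≟ a}) (fromWitness {a? = c y ≟ b}) colour))

  H-edge-unique : ∀ {z y₁ y₂} → Missing S c z a ⊎ Missing S c z b → T (H y₁) → T (H y₂) →
    Incident G y₁ z → Incident G y₂ z → y₁ ≡ y₂
  H-edge-unique {z} {y₁} {y₂} free h₁ h₂ i₁ i₂ with y₁ ≟ y₂
  ... | yes y₁≡y₂ = y₁≡y₂
  ... | no y₁≢y₂ = ⊥-elim (proper y₁ y₂ (H⇒S h₁) (H⇒S h₂) (y₁≢y₂ , z , i₁ , i₂)
                             (same-colour (H-colour h₁) (H-colour h₂)))
    where
    same-colour : c y₁ ≡ a ⊎ c y₁ ≡ b → c y₂ ≡ a ⊎ c y₂ ≡ b → c y₁ ≡ c y₂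
    same-colour (inj₁ p) (inj₁ q) = trans p (sym q)
    same-colour (inj₂ p) (inj₂ q) = trans p (sym q)
    same-colour (inj₁ p) (inj₂ q) =
      ⊥-elim ([ (λ free-a → free-a y₁ (H⇒S h₁) i₁ p) , (λ free-b → free-b y₂ (H⇒S h₂) i₂ q) ]′
                free)
    same-colour (inj₂ p) (inj₁ q) =
      ⊥-elim ([ (λ free-a → free-a y₂ (H⇒S h₂) i₂ q) , (λ free-b → free-b y₁ (H⇒S h₁) i₁ p) ]′
                free)

  no-three-H-edges-at : ∀ {t y₁ y₂ y₃} → T (H y₁) → T (H y₂) → T (H y₃) →
    Incident G y₁ t → Incident G y₂ t → Incident G y₃ t →
    y₁ ≢ y₂ → y₁ ≢ y₃ → y₂ ≢ y₃ → ⊥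
  no-three-H-edges-at {t} h₁ h₂ h₃ i₁ i₂ i₃ d₁₂ d₁₃ d₂₃
    with three-in-two (H-colour h₁) (H-colour h₂) (H-colour h₃)
  ... | inj₁ c₁≡c₂        = proper _ _ (H⇒S h₁) (H⇒S h₂) (d₁₂ , t , i₁ , i₂) c₁≡c₂
  ... | inj₂ (inj₁ c₁≡c₃) = proper _ _ (H⇒S h₁) (H⇒S h₃) (d₁₃ , t , i₁ , i₃) c₁≡c₃
  ... | inj₂ (inj₂ c₂≡c₃) = proper _ _ (H⇒S h₂) (H⇒S h₃) (d₂₃ , t , i₂ , i₃) c₂≡c₃

  TwoEdgesAt : EdgeSet G → V → Set
  TwoEdgesAt K z =
    ∃₂ λ y₁ y₂ → T (K y₁) × T (K y₂) × Incident G y₁ z × Incident G y₂ z × y₁ ≢ y₂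

  TwoEdgesAt-mono : ∀ {K K' z} → K ⊆ K' → TwoEdgesAt K z → TwoEdgesAt K' z
  TwoEdgesAt-mono K⊆K' (y₁ , y₂ , k₁ , k₂ , i₁ , i₂ , y₁≢y₂) =
    y₁ , y₂ , K⊆K' y₁ k₁ , K⊆K' y₂ k₂ , i₁ , i₂ , y₁≢y₂

  EndsAmong : EdgeSet G → V → V → Set
  EndsAmong K p q = ∀ z y → T (K y) → Incident G y z → z ≢ p → z ≢ q → TwoEdgesAt K z

  EndsAmong-sym : ∀ {K p q} → EndsAmong K p q → EndsAmong K q p
  EndsAmong-sym inner z y y∈K iy z≢q z≢p = inner z y y∈K iy z≢p z≢q

  extend-at-end : ∀ {K t q y y'} → EndsAmong K t q → T (K y) → Incident G y t → ¬ T (K y') →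
    (i' : Incident G y' t) → EndsAmong (insert K y') (other y' t i') q
  extend-at-end {K} {t} {y = y} {y'} inner y∈K iy y'∉K i' z x x∈K' ix z≢t' z≢q with z ≟ t
  ... | yes refl = y , y' , ⊆-insert K y' y y∈K , ∈-insert K y' , iy , i' , ∉⇒≢ K y'∉K y∈K ∘ sym
  ... | no z≢t with ∈-insert⁻ K y' x x∈K'
  ...   | inj₁ refl = ⊥-elim ([ z≢t , z≢t' ]′ (incident⇒end y' t i' ix))
  ...   | inj₂ x∈K = TwoEdgesAt-mono (⊆-insert K y') (inner z x x∈K ix z≢t z≢q)

  Closed : EdgeSet G → Set
  Closed K = ∀ y y' → T (K y) → T (H y') → Adjacent G y y' → T (K y')

  -- The component of g in H. Properness makes H a graph of maximum degree two, so the component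
  -- is a path or a cycle, and its vertices of degree one are among end₁ and end₂.
  record Chain (g : E) : Set where
    field
      K          : EdgeSet G
      K⊆H        : K ⊆ H
      g∈K        : T (K g)
      closed     : Closed K
      end₁ end₂  : V
      interior   : EndsAmong K end₁ end₂

  module _ (g : E) (g∈H : T (H g)) where

    private
      grow : ∀ K p q → K ⊆ H → T (K g) → EndsAmong K p q → Acc _<_ (count (not ∘ K)) → Chain g
      grow K p q K⊆H g∈K inner (acc rec)
        with any? (λ y → any? (λ y' →
               T? (K y) ×-dec T? (H y') ×-dec ¬? (T? (K y')) ×-dec adjacent? y y'))
      ... | no none = record
        { K = K ; K⊆H = K⊆H ; g∈K = g∈K ; closed = closed ; end₁ = p ; end₂ = q ; interior = inner }
        where
        closed : Closed K
        closed y y' y∈K y'∈H adj =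
          decidable-stable (T? (K y')) λ y'∉K → none (y , y' , y∈K , y'∈H , y'∉K , adj)
      ... | yes (y , y' , y∈K , y'∈H , y'∉K , (_ , t , iy , iy')) with new-ends
        where
        -- y' can only be attached at an end: an interior vertex already meets two H-edges of K.
        new-ends : ∃₂ λ p' q' → EndsAmong (insert K y') p' q'
        new-ends with t ≟ p | t ≟ q
        ... | yes refl | _        = _ , _ , extend-at-end inner y∈K iy y'∉K iy'
        ... | no _     | yes refl = _ , _ , extend-at-end (EndsAmong-sym inner) y∈K iy y'∉K iy'
        ... | no t≢p   | no t≢q   =
          let (y₁ , y₂ , k₁ , k₂ , i₁ , i₂ , y₁≢y₂) = inner t y y∈K iy t≢p t≢q
          in ⊥-elim (no-three-H-edges-at (K⊆H y₁ k₁) (K⊆H y₂ k₂) y'∈H i₁ i₂ iy' y₁≢y₂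
                       (∉⇒≢ K y'∉K k₁ ∘ sym) (∉⇒≢ K y'∉K k₂ ∘ sym))
      ... | p' , q' , inner' =
        grow (insert K y') p' q' K'⊆H (⊆-insert K y' g g∈K) inner'
             (rec (insert-shrinks-complement K y'∉K))
        where
        K'⊆H : insert K y' ⊆ H
        K'⊆H x x∈K' = [ (λ { refl → y'∈H }) , K⊆H x ]′ (∈-insert⁻ K y' x x∈K')

      ∅ : EdgeSet G
      ∅ _ = false

      initial-ends : EndsAmong (insert ∅ g) (proj₁ (ends G g)) (proj₂ (ends G g))
      initial-ends z x x∈ ix z≢p z≢q with ∈-insert⁻ ∅ g x x∈
      ... | inj₁ refl = ⊥-elim ([ z≢p ∘ sym , z≢q ∘ sym ]′ ix)

    chain : Chain g
    chain = grow (insert ∅ g) _ _ ⊆H (∈-insert ∅ g) initial-ends (<-wellFounded _)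
      where
      ⊆H : insert ∅ g ⊆ H
      ⊆H x x∈ with ∈-insert⁻ ∅ g x x∈
      ... | inj₁ refl = g∈H

  switch : EdgeSet G → E → Fin 3
  switch K y = if K y then transpose a b (c y) else c y

  switch-boundary : ∀ {K y y'} → K ⊆ H → Closed K → T (K y) → ¬ T (K y') → T (S y') →
    Adjacent G y y' → switch K y ≢ switch K y'
  switch-boundary {K} {y} {y'} K⊆H closed y∈K y'∉K y'∈S adj eq =
    y'∉K (closed y y' y∈K (H-intro y'∈S colour) adj)
    where
    colour : c y' ≡ a ⊎ c y' ≡ b
    colour = subst (λ x → x ≡ a ⊎ x ≡ b) (trans (sym (if-T y∈K)) (trans eq (if-¬T y'∉K)))
               (transpose-pair (H-colour (K⊆H y y∈K)))

  switch-proper : ∀ {K} → K ⊆ H → Closed K → ProperOn G 3 S (switch K)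
  switch-proper {K} K⊆H closed y₁ y₂ y₁∈S y₂∈S adj eq with T? (K y₁) | T? (K y₂)
  ... | yes k₁ | yes k₂ = proper y₁ y₂ y₁∈S y₂∈S adj
        (transpose-injective a b (trans (sym (if-T k₁)) (trans eq (if-T k₂))))
  ... | yes k₁ | no k₂ = switch-boundary K⊆H closed k₁ k₂ y₂∈S adj eq
  ... | no k₁  | yes k₂ = switch-boundary K⊆H closed k₂ k₁ y₁∈S (adjacent-sym adj) (sym eq)
  ... | no k₁  | no k₂ = proper y₁ y₂ y₁∈S y₂∈S adj
        (trans (sym (if-¬T k₁)) (trans eq (if-¬T k₂)))

  switch-keeps-missing : ∀ {K z k} → (∀ y → T (K y) → ¬ Incident G y z) →
    Missing S c z k → Missing S (switch K) z k
  switch-keeps-missing away free h h∈S ih =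
    free h h∈S ih ∘ trans (sym (if-¬T λ h∈K → away h h∈K ih))

  module _ {g} (C : Chain g) where

    open Chain C

    end-of-chain : ∀ {z y} → Missing S c z a ⊎ Missing S c z b → T (K y) → Incident G y z →
      z ≡ end₁ ⊎ z ≡ end₂
    end-of-chain {z} free y∈K iy with z ≟ end₁ | z ≟ end₂
    ... | yes z≡p | _       = inj₁ z≡p
    ... | no _    | yes z≡q = inj₂ z≡q
    ... | no z≢p  | no z≢q  =
      let (y₁ , y₂ , k₁ , k₂ , i₁ , i₂ , y₁≢y₂) = interior z _ y∈K iy z≢p z≢q
      in ⊥-elim (y₁≢y₂ (H-edge-unique free (K⊆H y₁ k₁) (K⊆H y₂ k₂) i₁ i₂))

    end-or-free : ∀ {z h} → Missing S c z a → T (S h) → Incident G h z → c h ≡ b →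
      (z ≡ end₁ ⊎ z ≡ end₂) ⊎ Missing S (switch K) z a
    end-or-free {z} {h} free h∈S ih ch≡b with T? (K h)
    ... | yes h∈K = inj₁ (end-of-chain (inj₁ free) h∈K ih)
    ... | no h∉K  = inj₂ (switch-keeps-missing away free)
      where
      away : ∀ y → T (K y) → ¬ Incident G y z
      away y y∈K iy = h∉K (subst (T ∘ K)
        (H-edge-unique (inj₁ free) (K⊆H y y∈K) (H-intro h∈S (inj₂ ch≡b)) iy ih) y∈K)

module Augmentation (G : Graph) (subcubic : Subcubic G) where

  open GraphFacts G
  open SubcubicFacts G subcubic

  private
    E = Fin (m G)

  kempe-extension : ∀ {S c e e' v g a b} → ProperOn G 3 S c → a ≢ b →
    ¬ T (S e) → ¬ T (S e') → e ≢ e' → (i : Incident G e v) (i' : Incident G e' v) →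
    (∀ h → T (S h) → Incident G h v → h ≡ g) → T (S g) → Incident G g v → c g ≡ a →
    Missing S c (other e v i) a → Present S c (other e v i) b →
    Missing S c (other e' v i') a → Present S c (other e' v i') b → Extensible S
  kempe-extension {S} {c} {e} {e'} {v} {g} {a} {b} proper a≢b e∉S e'∉S e≢e' i i' only-g g∈S ig cg≡a
    u-free (hu , hu∈S , ihu , chu≡b) w-free (hw , hw∈S , ihw , chw≡b) =
    settle (end-or-free C u-free hu∈S ihu chu≡b) (end-or-free C w-free hw∈S ihw chw≡b)
    where
    open KempeChains G proper {a} {b}

    C : Chain g
    C = chain g (H-intro g∈S (inj₁ cg≡a))

    open Chain C

    switched-proper : ProperOn G 3 S (switch K)
    switched-proper = switch-proper K⊆H closed

    switched-g : switch K g ≡ b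
    switched-g = begin
      switch K g             ≡⟨ if-T g∈K ⟩
      transpose a b (c g)    ≡⟨ cong (transpose a b) cg≡a ⟩
      transpose a b a        ≡⟨ transpose-left a b ⟩
      b                      ∎

    v-free : Missing S (switch K) v a
    v-free = only-edge-missing only-g λ b≡a → a≢b (sym (trans (sym switched-g) b≡a))

    v-end : v ≡ end₁ ⊎ v ≡ end₂
    v-end = end-of-chain C (inj₂ (only-edge-missing only-g λ a≡b → a≢b (trans (sym cg≡a) a≡b)))
                         g∈K ig

    -- Switching the chain frees a at v. The far end of e (or of e') still misses a unless the
    -- chain reaches it; if it reaches both, v and the two far ends are three ends of one chain.
    settle : (other e v i ≡ end₁ ⊎ other e v i ≡ end₂) ⊎ Missing S (switch K) (other e v i) a →
             (other e' v i' ≡ end₁ ⊎ other e' v i' ≡ end₂) ⊎ Missing S (switch K) (other e' v i') a →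
             Extensible S
    settle (inj₂ u-free') _              = colour-edge a switched-proper e∉S i v-free u-free'
    settle (inj₁ _)       (inj₂ w-free') = colour-edge a switched-proper e'∉S i' v-free w-free'
    settle (inj₁ u-end)   (inj₁ w-end) with three-in-two v-end u-end w-end
    ... | inj₁ v≡u        = ⊥-elim (other≢ e v i v≡u)
    ... | inj₂ (inj₁ v≡w) = ⊥-elim (other≢ e' v i' v≡w)
    ... | inj₂ (inj₂ u≡w) = ⊥-elim (e≢e' (other-injective e e' v i i' u≡w))

  augment : ∀ {S c e e' v} → ProperOn G 3 S c → ¬ T (S e) → ¬ T (S e') → e ≢ e' →
    Incident G e v → Incident G e' v → Extensible S
  augment {S} {c} {e} {e'} {v} proper e∉S e'∉S e≢e' i i'
    with missing-colour-exists S c e∉S (other-incident e v i)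
  ... | a , u-free-a with present-or-missing S c v a
  ...   | inj₂ v-free-a = colour-edge a proper e∉S i v-free-a u-free-a
  ...   | inj₁ (g , g∈S , ig , cg≡a) = colour-e-or-e'
    where
    only-g : ∀ h → T (S h) → Incident G h v → h ≡ g
    only-g h h∈S ih = coloured-edge-unique S e∉S e'∉S e≢e' i i' h∈S g∈S ih ig

    v-free : ∀ {k} → k ≢ a → Missing S c v k
    v-free k≢a = only-edge-missing only-g λ cg≡k → k≢a (trans (sym cg≡k) cg≡a)

    b = punchIn a zero
    b≢a = punchInᵢ≢i a zero

    colour-e-or-e' : Extensible S
    colour-e-or-e'
      with present-or-missing S c (other e v i) b
         | missing-colour-exists S c e'∉S (other-incident e' v i')
    ... | inj₂ u-free-b | _ = colour-edge b proper e∉S i (v-free b≢a) u-free-b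
    ... | inj₁ u-has-b  | k , w-free-k with k ≟ a
    ...   | no k≢a = colour-edge k proper e'∉S i' (v-free k≢a) w-free-k
    ...   | yes refl with present-or-missing S c (other e' v i') b
    ...     | inj₂ w-free-b = colour-edge b proper e'∉S i' (v-free b≢a) w-free-b
    ...     | inj₁ w-has-b  = kempe-extension proper (b≢a ∘ sym) e∉S e'∉S e≢e' i i'
                                only-g g∈S ig cg≡a u-free-a u-has-b w-free-k w-has-b

  SmallLastClass : EdgeSet G → Set
  SmallLastClass S = ∃ λ f → ProperColouring G 4 f × classSize G f (fromℕ 3) ≤ count (not ∘ S)

  uncoloured-matching-colouring : ∀ {S c} → ProperOn G 3 S c →
    (∀ e e' → ¬ T (S e) → ¬ T (S e') → ¬ Adjacent G e e') → SmallLastClass S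
  uncoloured-matching-colouring {S} {c} proper matching = f , f-proper , small
    where
    f : E → Fin 4
    f y = if S y then inject₁ (c y) else fromℕ 3

    f-proper : ProperColouring G 4 f
    f-proper y₁ y₂ _ _ adj eq with T? (S y₁) | T? (S y₂)
    ... | yes s₁ | yes s₂ = proper y₁ y₂ s₁ s₂ adj
          (inject₁-injective (trans (sym (if-T s₁)) (trans eq (if-T s₂))))
    ... | yes s₁ | no s₂  = fromℕ≢inject₁ (trans (sym (if-¬T s₂)) (trans (sym eq) (if-T s₁)))
    ... | no s₁  | yes s₂ = fromℕ≢inject₁ (trans (sym (if-¬T s₁)) (trans eq (if-T s₂)))
    ... | no s₁  | no s₂  = matching y₁ y₂ s₁ s₂ adj

    last⊆∁S : (λ y → ⌊ f y ≟ fromℕ 3 ⌋) ⊆ (not ∘ S)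
    last⊆∁S y last = T-not⁺ λ y∈S → fromℕ≢inject₁ (trans (sym (toWitness last)) (if-T y∈S))

    small : classSize G f (fromℕ 3) ≤ count (not ∘ S)
    small = subst (_≤ count (not ∘ S)) (sym (countB≡count (λ y → ⌊ f y ≟ fromℕ 3 ⌋)))
                  (count-mono last⊆∁S)

  extend-to-four-colouring : ∀ {S c} → ProperOn G 3 S c → SmallLastClass S
  extend-to-four-colouring proper = go proper (<-wellFounded _)
    where
    go : ∀ {S c} → ProperOn G 3 S c → Acc _<_ (count (not ∘ S)) → SmallLastClass S
    go {S} proper (acc rec)
      with any? (λ e → any? (λ e' → ¬? (T? (S e)) ×-dec ¬? (T? (S e')) ×-dec adjacent? e e'))
    ... | no none = uncoloured-matching-colouring proper
                      λ e e' e∉S e'∉S adj → none (e , e' , e∉S , e'∉S , adj)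
    ... | yes (e , e' , e∉S , e'∉S , (e≢e' , v , i , i'))
      with augment proper e∉S e'∉S e≢e' i i'
    ...   | x , x∉S , c' , proper' =
      let (f , f-proper , small) = go proper' (rec shrinks)
      in f , f-proper , ≤-trans small (<⇒≤ shrinks)
      where
      shrinks = insert-shrinks-complement S x∉S

module Resistance (G : Graph) (subcubic : Subcubic G) where

  open GraphFacts G
  open Augmentation G subcubic

  private
    E = Fin (m G)

  HasClassOfSize : ℕ → Set
  HasClassOfSize j = ∃ λ (f : E → Fin 4) → ProperColouring G 4 f × ∃ λ i → classSize G f i ≡ j

  classSize-cong : ∀ {k} {f f' : E → Fin k} i → f ≗ f' → classSize G f i ≡ classSize G f' i
  classSize-cong {f = f} {f'} i f≗f' = begin
    classSize G f i                 ≡⟨ countB≡count (λ e → ⌊ f e ≟ i ⌋) ⟩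
    count (λ e → ⌊ f e ≟ i ⌋)       ≡⟨ count-cong (λ e → cong (λ x → ⌊ x ≟ i ⌋) (f≗f' e)) ⟩
    count (λ e → ⌊ f' e ≟ i ⌋)      ≡⟨ countB≡count (λ e → ⌊ f' e ≟ i ⌋) ⟨
    classSize G f' i                ∎

  hasClassOfSize? : ∀ j → Dec (HasClassOfSize j)
  hasClassOfSize? j = any-function? (m G) _
    (λ f → proper? (allEdges G) f ×-dec any? (λ i → classSize G f i Data.Nat.≟ j))
    λ f≗f' (proper , i , size) →
      proper-cong f≗f' proper , i , trans (sym (classSize-cong i f≗f')) size

  squeeze : Fin 4 → Fin 4 → Fin 3
  squeeze i x with i ≟ x
  ... | yes _  = zero
  ... | no i≢x = punchOut i≢x

  squeeze-injective : ∀ i {x y} → x ≢ i → y ≢ i → squeeze i x ≡ squeeze i y → x ≡ y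
  squeeze-injective i {x} {y} x≢i y≢i eq with i ≟ x | i ≟ y
  ... | yes i≡x | _       = ⊥-elim (x≢i (sym i≡x))
  ... | no _    | yes i≡y = ⊥-elim (y≢i (sym i≡y))
  ... | no i≢x  | no i≢y  = punchOut-injective i≢x i≢y eq

  colour-class-representative : ∀ {f} → ProperColouring G 4 f → ∀ i →
    RepresentativeConflictingSubset G (λ e → ⌊ f e ≟ i ⌋)
  colour-class-representative {f} proper i M (conflicting , _) =
    decidable-stable (any? λ e → T? (M e) ×-dec T? ⌊ f e ≟ i ⌋) λ disjoint →
      conflicting ((squeeze i ∘ f) , λ e e' e∈M e'∈M adj eq →
        proper e e' _ _ adj (squeeze-injective i (outside disjoint e∈M) (outside disjoint e'∈M) eq))
    where
    outside : ∀ {e} → ¬ (∃ λ e → T (M e) × T ⌊ f e ≟ i ⌋) → T (M e) → f e ≢ i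
    outside disjoint e∈M fe≡i = disjoint (_ , e∈M , fromWitness fe≡i)

  complement-colourable : ∀ {R} → RepresentativeConflictingSubset G R → Colourable G 3 (not ∘ R)
  complement-colourable {R} representative =
    decidable-stable (colourable? (not ∘ R)) λ conflicting →
      let (M , minimal , M⊆∁R) = minimal-conflicting-within (not ∘ R) conflicting
          (e , e∈M , e∈R) = representative M minimal
      in T-not⁻ (M⊆∁R e e∈M) e∈R

  four-colouring : ∃ HasClassOfSize
  four-colouring =
    let (f , proper , _) = extend-to-four-colouring {S = λ _ → false} {c = λ _ → zero} λ _ _ ()
    in _ , f , proper , zero , refl

  representative-bounds-class : ∀ {R} → RepresentativeConflictingSubset G R →
    ∃ λ j → HasClassOfSize j × j ≤ countB R
  representative-bounds-class {R} representative =
    let (_ , proper) = complement-colourable representative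
        (f , f-proper , small) = extend-to-four-colouring proper
    in _ , (f , f-proper , fromℕ 3 , refl) , ≤-trans small (≤-reflexive (begin
         count (not ∘ not ∘ R)   ≡⟨ count-cong (not-involutive ∘ R) ⟩
         count R                 ≡⟨ countB≡count R ⟨
         countB R                ∎))

theorem2p6 : (G : Graph) → ClassTwo G →
    Σ ℕ (λ r → IsResistance G r × IsMinRepresentativeSize G r)
theorem2p6 G (subcubic , _) =
  let (r , (f , f-proper , i , |class|≡r) , r-least) =
        least-witness HasClassOfSize hasClassOfSize? (proj₂ four-colouring)
  in r , ((f , f-proper , i , |class|≡r) , λ f' f'-proper i' → r-least _ (f' , f'-proper , i' , refl))
       , ((λ e → ⌊ f e ≟ i ⌋) , colour-class-representative f-proper i , |class|≡r)
       , λ R representative →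
           let (j , has-j , j≤|R|) = representative-bounds-class representative
           in ≤-trans (r-least j has-j) j≤|R|
  where
  open Resistance G subcubic
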